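{- Let $M$ be a reachable marking of a t-net $N$ with generator place $s_\eta$, and let $R\in\mathit{repr}(M)$. Then for every place $s$ of $N$ with $s\neq s_\eta$, $$M(s)=\bigcup_{\langle\pi,t\rangle\in\mathit{Trees}(R)}M_t(s).$$
   Context: Process identifiers (pids). $\mathbb{P}=(\mathbb{N}^+)^*$ is the set of finite tuples of positive integers, including the empty tuple $\langle\rangle$, under concatenation; $\langle a_1,\dots,a_n\rangle$ is written $a_1.\cdots.a_n$. For $\pi=\langle a_1,\dots,a_n\rangle$: $\mathit{prefix}(\pi)=\langle a_1,\dots,a_{n-1}\rangle$ if $n>0$, else $\langle\rangle$; $\mathit{subpid}(\pi)=\{\pi\}\cup\mathit{subpid}(\mathit{prefix}(\pi))$ if $n>0$, $\emptyset$ if $n=0$. $\mathbb P$ is totally ordered hierarchically: by length, then lexicographically. Coloured Petri nets and t-nets. Fix data values $\mathbb D\supseteq\mathbb N$ (disjoint from $\mathbb P$), variables $\mathbb V$, expressions $\mathbb E\supseteq\mathbb V\cup\mathbb D$; bindings are partial maps $\beta:\mathbb V\to\mathbb P\cup\mathbb D$ extended to expressions. A Petri net $(S,T,\ell)$ has finite disjoint places and transitions, place types $\ell(s)=X_1\times\dots\times X_k$ ($X_i\in\{\mathbb P,\mathbb D\}$), guards $\ell(t)\in\mathbb E$ and arc labels $\ell(x,y)$ (multisets over $\mathbb E$). A marking maps each place to a multiset of tokens of its type; $M\xrightarrow{t,\beta}M'$ iff $M(s)\ge\beta(\ell(s,t))$, $\beta(\ell(t,s))$ has type $\ell(s)$ and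 $M'(s)=M(s)-\beta(\ell(s,t))+\beta(\ell(t,s))$ for all $s$, and $\beta(\ell(t))$ holds. A t-net additionally has: a unique generator place $s_\eta$ of type $\mathbb P\times\mathbb N$; initial marking with $M_0(s_\eta)=\{\langle\langle1\rangle,0\rangle\}$ and other places empty or containing only data; for each $t$, $\ell(s_\eta,t)=\{\langle p_i,c_i\rangle:1\le i\le k\}$ (distinct variables) and $\ell(t,s_\eta)=\{\langle p_i,c_i+n_i\rangle:1\le i\le m\}\cup\{\langle p_i.(c_i+j),0\rangle:1\le i\le k,1\le j\le n_i\}$ ($m\le k$, $n_i\ge0$), $\Pi_t$ being the set of the $p_i.(c_i+j)$; arcs from $s\ne s_\eta$ carry vectors of variables and data values; arcs to $s\ne s_\eta$ carry vectors of expressions over data variables/values and elements of $\Pi_t\cup\{p_1,\dots,p_m\}$; guards are computable Boolean expressions where pids are only compared by equality, parent, ancestor and (immediate/general) younger-sibling relations. Reachable markings are those reached from $M_0$ by finitely many firings. Pid-trees. $\Xi$ is the least set with $\langle M,C\rangle\in\Xi$ for a marking $M$ and $C=\langle\langle a_1,t_1\rangle,\dots,\langle a_n,t_n\rangle\rangle$, $t_i\in\Xi$, $a_i\in\mathbb P\setminus\{\langle\rangle\}$, and for $i\ne j$: $a_i\ne a_j$, $a_i\notin\mathit{subpid}(a_j)$, $a_j\notin\mathit{subpid}(a_i)$; written $M\xrightarrow{a_1,\dots,a_n}\langle t_1,\dots,t_n\rangle$; $M_t$ denotes the root marking of $t$. Inclusion: $\langle M',\langle\langle a'_i,t'_i\rangle\rangle_{i\le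 m}\rangle\subseteq\langle M,\langle\langle a_j,t_j\rangle\rangle_{j\le n}\rangle$ iff $M'\le M$ and each $i$ has $j$ with $a'_i=a_j$, $t'_i\subseteq t_j$. Subtrees: $\langle\langle\rangle,t_0\rangle\in\mathit{Trees}(t_0)$ and $\langle a_i.\pi',t\rangle\in\mathit{Trees}(t_0)$ if $\langle\pi',t\rangle\in\mathit{Trees}(t_i)$. $\mathit{pid}(t)=\{\pi:\langle\pi,t'\rangle\in\mathit{Trees}(t)\}$. A path labelled $\pi$ decorated by $M'$ is a pid-tree $t$ with $\pi\in\mathit{pid}(t)\subseteq\mathit{subpid}(\pi)\cup\{\langle\rangle\}$, $\langle\pi,\langle M',\langle\rangle\rangle\rangle\in\mathit{Trees}(t)$, all other node markings empty; "$R$ contains $\mathit{path}(\pi,M')$" means some such path is $\subseteq R$; $\mathit{path}(\pi)=\mathit{path}(\pi,\emptyset)$. Sibling ordered: at every node $a_1\le\dots\le a_n$ hierarchically. Representations. $\mathit{repr}(M)$ is the set of sibling ordered pid-trees $R$ built so that for each place $s$ of type $X_1\times\dots\times X_n$ and each token $v=\langle x_1,\dots,x_n\rangle\in M(s)$ exactly one rule applies, and $R$ contains nothing beyond what the rules require (tokens with multiplicity): generator rule ($s=s_\eta$, $v=\langle\pi,i\rangle$): $R$ contains $\mathit{path}(\pi)$ and $\mathit{path}(\pi.(i+1))$; shared rule ($X_1=\mathbb D$): $R$ contains $\mathit{path}(\langle\rangle,\{(s,v)\})$ (single token $v$ in $s$) and $\mathit{path}(x_i)$ for every $X_i=\mathbb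 P$; owned rule ($X_1=\mathbb P$): $R$ contains $\mathit{path}(x_1,\{(s,v)\})$ and $\mathit{path}(x_i)$ for every $X_i=\mathbb P$. The union in the claim is the multiset union over all subtrees. -}

module Defs where

open import Level using (0ℓ)
open import Data.Nat using (ℕ; zero; suc; _+_; _<_; _≤_)
open import Data.Nat.Properties using () renaming (_≟_ to _≟ℕ_)
open import Data.Bool using (Bool; true; false)
open import Data.List using (List; []; _∷_; _++_; map; filter; length; concat; concatMap; [_]; _∷ʳ_; lookup)
open import Data.List.Properties using (≡-dec)
open import Data.List.Membership.Propositional using (_∈_)
open import Data.List.Relation.Unary.All using (All)
open import Data.List.Relation.Unary.Any using (Any)
open import Data.List.Relation.Unary.AllPairs using (AllPairs)
open import Data.List.Relation.Unary.Linked using (Linked)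
open import Data.List.Relation.Unary.Unique.Propositional using (Unique)
open import Data.List.Relation.Binary.Permutation.Propositional using (_↭_)
import Data.List.Relation.Binary.Pointwise as LP
import Data.Vec.Relation.Binary.Pointwise.Inductive as VP
open import Data.Vec using (Vec; toList; tabulate) renaming (lookup to vlookup)
open import Data.Fin using (Fin; fromℕ; inject≤; toℕ) renaming (_≟_ to _≟F_)
open import Data.Product using (Σ; ∃; ∃₂; _×_; _,_; proj₁; proj₂)
open import Data.Sum using (_⊎_)
open import Data.Unit using (⊤)
open import Relation.Binary.PropositionalEquality using (_≡_; _≢_)
open import Relation.Nullary using (¬_; Dec; yes; no)
open import Function using (Injective)

-- Process identifiers.  P = (ℕ⁺)* is represented by lists of naturals;
-- IsPid singles out those whose entries are all positive.

Pid : Set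
Pid = List ℕ

IsPid : Pid → Set
IsPid π = All (λ a → 0 < a) π

_≟ₚ_ : (π π' : Pid) → Dec (π ≡ π')
_≟ₚ_ = ≡-dec _≟ℕ_

prefix : Pid → Pid
prefix []           = []
prefix (a ∷ [])     = []
prefix (a ∷ b ∷ π)  = a ∷ prefix (b ∷ π)

-- subpid(π) = {π} ∪ subpid(prefix π), subpid(⟨⟩) = ∅ : the set of all
-- non-empty prefixes of π (written out by structural recursion)
subpid : Pid → List Pid
subpid []      = []
subpid (a ∷ π) = [ a ] ∷ map (a ∷_) (subpid π)

data _≤lex_ : Pid → Pid → Set where
  []≤lex : ∀ {π} → [] ≤lex π
  <≤lex  : ∀ {a b π π'} → a < b → (a ∷ π) ≤lex (b ∷ π')
  ≡≤lex  : ∀ {a π π'} → π ≤lex π' → (a ∷ π) ≤lex (a ∷ π')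

_≤ₕ_ : Pid → Pid → Set
π ≤ₕ π' = length π < length π' ⊎ (length π ≡ length π' × π ≤lex π')

module Core (D : Set) (ι : ℕ → D) (Place : Set) where

  data Val : Set where
    pidV : Pid → Val
    datV : D → Val

  Token : Set
  Token = List Val

  -- component types: 𝐏 (pids), 𝐃 (data), 𝐍 (naturals ⊆ D, used only for
  -- the counter component of the generator place)
  data Ty : Set where
    𝐏 𝐃 𝐍 : Ty

  -- a place type X₁ × ⋯ × Xₖ (k ≥ 1): first component and the rest
  PlaceType : Set
  PlaceType = Ty × List Ty

  Var : Set
  Var = ℕ

  Binding : Set
  Binding = Var → Val

  -- a marking: a finite multiset of tokens per place (lists up to ↭)
  Marking : Set
  Marking = Place → List Token

  ∅ᴹ : Marking
  ∅ᴹ _ = []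

  _≈ᴹ_ : Marking → Marking → Set
  M ≈ᴹ M' = ∀ s → M s ↭ M' s

  _≤ᴹ_ : Marking → Marking → Set
  M' ≤ᴹ M = ∀ s → ∃ λ rest → M s ↭ M' s ++ rest

  HasTy : Ty → Val → Set
  HasTy 𝐏 v = ∃ λ π → v ≡ pidV π
  HasTy 𝐃 v = ∃ λ d → v ≡ datV d
  HasTy 𝐍 v = ∃ λ c → v ≡ datV (ι c)

  HasType : PlaceType → Token → Set
  HasType (X , Xs) v = LP.Pointwise HasTy (X ∷ Xs) v

  IsData : Val → Set
  IsData v = ∃ λ d → v ≡ datV d

  genToken : Pid → ℕ → Token
  genToken π c = pidV π ∷ datV (ι c) ∷ []

  data Pat : Set where
    pvar : Var → Pat
    pval : D → Pat

  evalPat : Binding → Pat → Val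
  evalPat β (pvar x) = β x
  evalPat β (pval d) = datV d

  data DExpr : Set where
    dvar : Var → DExpr
    dval : D → DExpr
    dapp : ∀ {n} → (Vec D n → D) → Vec DExpr n → DExpr

  data _⊢_⇓_ (β : Binding) : DExpr → D → Set where
    ⇓var : ∀ {x d} → β x ≡ datV d → β ⊢ dvar x ⇓ d
    ⇓val : ∀ {d} → β ⊢ dval d ⇓ d
    ⇓app : ∀ {n} {f : Vec D n → D} {es ds} →
           VP.Pointwise (β ⊢_⇓_) es ds → β ⊢ dapp f es ⇓ f ds

  -- expressions on arcs to ordinary places of a transition with k
  -- generator inputs, m of them returned, with n_i new children each:
  -- data expressions, new pids p_i.(c_i+j) ∈ Π_t (j = suc j' ∈ 1..n_i),
  -- or the returned pids p_1 … p_m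
  data OutExpr (k m : ℕ) (n : Vec ℕ k) : Set where
    dexp   : DExpr → OutExpr k m n
    newPid : (i : Fin k) → Fin (vlookup n i) → OutExpr k m n
    oldPid : Fin m → OutExpr k m n

  data Guard : Set where
    gtrue                     : Guard
    gnot                      : Guard → Guard
    gand gor                  : Guard → Guard → Guard
    pidEq parentOf ancestorOf
      immYoungerSibOf youngerSibOf : Var → Var → Guard
    dataAtom                  : (xs : List Var) → (Vec D (length xs) → Bool) → Guard

  PidRel : Set₁
  PidRel = Pid → Pid → Set

  Parent : PidRel
  Parent π π' = ∃ λ a → π' ≡ π ∷ʳ a

  Ancestor : PidRel
  Ancestor π π' = π ∈ subpid (prefix π')

  -- π is a younger sibling of π' (created later by the same parent)
  YoungerSib : PidRel
  YoungerSib π π' = ∃₂ λ p a → ∃ λ b → π ≡ p ∷ʳ a × π' ≡ p ∷ʳ b × b < a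

  ImmYoungerSib : PidRel
  ImmYoungerSib π π' = ∃ λ p → ∃ λ b → π ≡ p ∷ʳ suc b × π' ≡ p ∷ʳ b

  pidAtom : PidRel → Binding → Var → Var → Set
  pidAtom Rel β x y = ∃₂ λ π π' → β x ≡ pidV π × β y ≡ pidV π' × Rel π π'

  ⟦_⟧ᵍ : Guard → Binding → Set
  ⟦ gtrue ⟧ᵍ β               = ⊤
  ⟦ gnot g ⟧ᵍ β              = ¬ ⟦ g ⟧ᵍ β
  ⟦ gand g h ⟧ᵍ β            = ⟦ g ⟧ᵍ β × ⟦ h ⟧ᵍ β
  ⟦ gor g h ⟧ᵍ β             = ⟦ g ⟧ᵍ β ⊎ ⟦ h ⟧ᵍ β
  ⟦ pidEq x y ⟧ᵍ β           = pidAtom _≡_ β x y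
  ⟦ parentOf x y ⟧ᵍ β        = pidAtom Parent β x y
  ⟦ ancestorOf x y ⟧ᵍ β      = pidAtom Ancestor β x y
  ⟦ immYoungerSibOf x y ⟧ᵍ β = pidAtom ImmYoungerSib β x y
  ⟦ youngerSibOf x y ⟧ᵍ β    = pidAtom YoungerSib β x y
  ⟦ dataAtom xs f ⟧ᵍ β       =
    ∃ λ (ds : Vec D (length xs)) →
      (∀ i → β (lookup xs i) ≡ datV (vlookup ds i)) × f ds ≡ true

  record TransSpec : Set where
    field
      k      : ℕ                 -- generator inputs ⟨p_i, c_i⟩, 1 ≤ i ≤ k
      m      : ℕ                 -- the first m are returned
      m≤k    : m ≤ k
      pv cv  : Vec Var k
      distinct : Unique (toList pv ++ toList cv)
      n      : Vec ℕ k
      guard  : Guard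
      -- arcs from / to places s ≠ s_η (entries for s_η are ignored;
      -- the generator arcs are determined by k, m, pv, cv, n)
      inArc  : Place → List (List Pat)
      outArc : Place → List (List (OutExpr k m n))

record TNet : Set₁ where
  field
    D      : Set                  -- data values, D ⊇ ℕ
    ι      : ℕ → D
    ι-inj  : Injective _≡_ _≡_ ι
    nS nT  : ℕ

  Place : Set
  Place = Fin nS

  Trans : Set
  Trans = Fin nT

  open Core D ι Place public

  field
    ℓ      : Place → PlaceType
    sη     : Place
    ℓ-sη   : ℓ sη ≡ (𝐏 , 𝐍 ∷ [])
    ℓ-PD   : ∀ s → s ≢ sη → ¬ (proj₁ (ℓ s) ≡ 𝐍) × All (_≢ 𝐍) (proj₂ (ℓ s))
    trans  : Trans → TransSpec

  field
    M₀       : Marking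
    M₀-sη    : M₀ sη ≡ [ genToken (1 ∷ []) 0 ]
    M₀-data  : ∀ s → s ≢ sη → All (All IsData) (M₀ s)
    M₀-typed : ∀ s → All (HasType (ℓ s)) (M₀ s)

module _ (N : TNet) where
  open TNet N

  module _ (t : Trans) where
    open TransSpec (trans t)

    -- β(ℓ(s_η,t)) for β(p_i) = ps_i, β(c_i) = cs_i
    genIn : Vec Pid k → Vec ℕ k → List Token
    genIn ps cs = toList (tabulate λ i → genToken (vlookup ps i) (vlookup cs i))

    genOut : Vec Pid k → Vec ℕ k → List Token
    genOut ps cs =
      toList (tabulate λ (i : Fin m) →
        genToken (vlookup ps (inject≤ i m≤k))
                 (vlookup cs (inject≤ i m≤k) + vlookup n (inject≤ i m≤k)))
      ++ concat (toList (tabulate λ i →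
           toList (tabulate λ (j : Fin (vlookup n i)) →
             genToken (vlookup ps i ∷ʳ (vlookup cs i + suc (toℕ j))) 0)))

    data OutVal (β : Binding) (ps : Vec Pid k) (cs : Vec ℕ k) : OutExpr k m n → Val → Set where
      ov-dexp : ∀ {e d} → β ⊢ e ⇓ d → OutVal β ps cs (dexp e) (datV d)
      ov-new  : ∀ {i j} → OutVal β ps cs (newPid i j)
                   (pidV (vlookup ps i ∷ʳ (vlookup cs i + suc (toℕ j))))
      ov-old  : ∀ {i} → OutVal β ps cs (oldPid i) (pidV (vlookup ps (inject≤ i m≤k)))

    In : Binding → Vec Pid k → Vec ℕ k → Place → List Token
    In β ps cs s with s ≟F sη
    ... | yes _ = genIn ps cs
    ... | no  _ = map (map (evalPat β)) (inArc s)

    Out : Vec Pid k → Vec ℕ k → (Place → List Token) → Place → List Token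
    Out ps cs out s with s ≟F sη
    ... | yes _ = genOut ps cs
    ... | no  _ = out s

    record Fires (M : Marking) (β : Binding) (M' : Marking) : Set where
      field
        ps    : Vec Pid k
        cs    : Vec ℕ k
        ps-ok : ∀ i → β (vlookup pv i) ≡ pidV (vlookup ps i)
        cs-ok : ∀ i → β (vlookup cv i) ≡ datV (ι (vlookup cs i))
        guard-ok : ⟦ guard ⟧ᵍ β
        out     : Place → List Token
        out-ok  : ∀ s → s ≢ sη →
                  LP.Pointwise (LP.Pointwise (OutVal β ps cs)) (outArc s) (out s)
        out-typed : ∀ s → All (HasType (ℓ s)) (Out ps cs out s)
        update    : ∀ s → ∃ λ rest → (M s ↭ In β ps cs s ++ rest) ×
                                        (M' s ↭ Out ps cs out s ++ rest)

  data Reachable : Marking → Set where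
    initial : ∀ {M} → M ≈ᴹ M₀ → Reachable M
    step    : ∀ {M M' t β} → Reachable M → Fires t M β M' → Reachable M'

module _ (N : TNet) where
  open TNet N

  -- raw pid-trees  M --a₁,…,aₙ--> ⟨t₁,…,tₙ⟩
  data PTree : Set where
    node : Marking → List (Pid × PTree) → PTree

  rootM : PTree → Marking
  rootM (node M _) = M

  children : PTree → List (Pid × PTree)
  children (node _ cs) = cs

  mutual
    Trees : PTree → List (Pid × PTree)
    Trees (node M cs) = ([] , node M cs) ∷ childTrees cs

    childTrees : List (Pid × PTree) → List (Pid × PTree)
    childTrees []             = []
    childTrees ((a , u) ∷ cs) =
      map (λ p → (a ++ proj₁ p , proj₂ p)) (Trees u) ++ childTrees cs

  pids : PTree → List Pid
  pids t = map proj₁ (Trees t)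

  Apart : Pid → Pid → Set
  Apart a b = a ≢ b × ¬ (a ∈ subpid b) × ¬ (b ∈ subpid a)

  data WF : PTree → Set where
    wf : ∀ {M cs} →
         (∀ s → All (HasType (ℓ s)) (M s)) →
         All (λ c → proj₁ c ≢ [] × IsPid (proj₁ c)) cs →
         AllPairs (λ c c' → Apart (proj₁ c) (proj₁ c')) cs →
         All (λ c → WF (proj₂ c)) cs →
         WF (node M cs)

  data _⊆ᵗ_ : PTree → PTree → Set where
    ⊆node : ∀ {M' cs' M cs} → M' ≤ᴹ M →
            All (λ c' → Any (λ c → proj₁ c' ≡ proj₁ c × proj₂ c' ⊆ᵗ proj₂ c) cs) cs' →
            node M' cs' ⊆ᵗ node M cs

  data SiblingOrdered : PTree → Set where
    sorted : ∀ {M cs} →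
             Linked (λ c c' → proj₁ c ≤ₕ proj₁ c') cs →
             All (λ c → SiblingOrdered (proj₂ c)) cs →
             SiblingOrdered (node M cs)

  IsPath : PTree → Pid → Marking → Set
  IsPath t π M' =
    WF t × π ∈ pids t ×
    All (λ π' → π' ∈ subpid π ⊎ π' ≡ []) (pids t) ×
    (∃ λ u → (π , u) ∈ Trees t × children u ≡ [] × rootM u ≈ᴹ M') ×
    (∀ π' u → (π' , u) ∈ Trees t → π' ≢ π → rootM u ≈ᴹ ∅ᴹ)

  ContainsPath : PTree → Pid → Marking → Set
  ContainsPath R π M' = ∃ λ t → IsPath t π M' × t ⊆ᵗ R

  -- the pid at which a token of an ordinary place s is stored:
  -- x₁ for the owned rule (X₁ = 𝐏), ⟨⟩ for the shared rule (X₁ = 𝐃)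
  loc : Place → Token → Pid
  loc s v with proj₁ (ℓ s) | v
  ... | 𝐏 | pidV π ∷ _ = π
  ... | _ | _          = []

  pidComps : List Ty → Token → List Pid
  pidComps (𝐏 ∷ Xs) (pidV π ∷ vs) = π ∷ pidComps Xs vs
  pidComps (_ ∷ Xs) (_ ∷ vs)      = pidComps Xs vs
  pidComps _        _             = []

  Need : Marking → Pid → Marking
  Need M π s with s ≟F sη
  ... | yes _ = []
  ... | no  _ = filter (λ v → loc s v ≟ₚ π) (M s)

  Requires : PTree → Marking → Set
  Requires R M =
    (∀ π i → genToken π i ∈ M sη →
       ContainsPath R π ∅ᴹ × ContainsPath R (π ∷ʳ suc i) ∅ᴹ) ×
    (∀ s → s ≢ sη → ∀ v → v ∈ M s →
       ContainsPath R (loc s v) (Need M (loc s v)) ×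
       All (λ x → ContainsPath R x ∅ᴹ) (pidComps (proj₁ (ℓ s) ∷ proj₂ (ℓ s)) v))

  _∈repr_ : PTree → Marking → Set
  R ∈repr M =
    WF R × SiblingOrdered R × Requires R M ×
    (∀ R' → WF R' → R' ⊆ᵗ R → Requires R' M → R ⊆ᵗ R')

  unionTrees : PTree → Place → List Token
  unionTrees R s = concatMap (λ p → rootM (proj₂ p) s) (Trees R)

module Submission where

-- Let R ∈ repr(M) and let s ≠ s_η be an ordinary place.  The
-- rules put every token v ∈ M(s) at the node loc(s,v) of R (its owner pid x₁
-- for the owned rule, the root ⟨⟩ for the shared rule), so we compare each
-- node ⟨π,w⟩ of R with Need M π, the tokens the rules assign to π:
--   * Need M π ≤ M_w, because R contains path(π, Need M π) and the pids of
--     a well-formed pid-tree are pairwise distinct;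
--   * M_w ≤ Need M π, because relabelling every node π of R by Need M π gives
--     a well-formed pid-tree (the core of R) included in R that still
--     satisfies all the rules, so the minimality of R forces R ⊆ core.
-- Hence M_w(s) ↭ Need M π (s) at every node, and the union over Trees(R) is
-- the union, over the distinct pids of R, of the tokens of M(s) located
-- there; since every such location is a pid of R, this is M(s) itself.

open import Defs
open import Data.Nat using (_+_)
open import Data.Nat.Properties using (+-assoc; +-identityʳ; +-cancelˡ-≡; m+n≡0⇒m≡0)
open import Data.List using (List; []; _∷_; _++_; map; filter; length; concatMap)
open import Data.List.Properties
  using (length-++; ++-identityʳ; map-++; map-∘; ∷-injective; ++-cancelˡ; filter-accept; filter-reject; concatMap-map; concatMap-cong)
open import Data.List.Membership.Propositional using (_∈_; _∉_)
open import Data.List.Membership.Propositional.Properties using (∈-map⁺; ∈-map⁻; ∈-++⁺ˡ; ∈-++⁺ʳ; ∈-++⁻; ∈-filter⁻)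
open import Data.List.Relation.Unary.Any using (Any; here; there)
open import Data.List.Relation.Unary.All as All using (All; []; _∷_)
import Data.List.Relation.Unary.All.Properties as All
open import Data.List.Relation.Unary.AllPairs using (AllPairs; []; _∷_)
open import Data.List.Relation.Unary.Unique.Propositional using (Unique)
import Data.List.Relation.Unary.Unique.Propositional.Properties as Unique
open import Data.List.Relation.Binary.Permutation.Propositional
  using (_↭_; ↭-refl; ↭-sym; ↭-trans; ↭-reflexive; prep; module PermutationReasoning)
open import Data.List.Relation.Binary.Permutation.Propositional.Properties
  using (↭-length; ++⁺ˡ; ++⁺ʳ; ++⁺; shift; All-resp-↭) renaming (++-assoc to ↭-++-assoc)
open import Data.Product using (∃; _,_; proj₁; proj₂; _×_)
import Data.Product as Product
open import Data.Sum using (_⊎_; inj₁; inj₂)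
open import Data.Fin using () renaming (_≟_ to _≟F_)
open import Data.Empty using (⊥-elim)
open import Relation.Binary.Definitions using (DecidableEquality)
open import Relation.Binary.PropositionalEquality
  using (_≡_; _≢_; refl; sym; trans; cong; cong₂; subst; module ≡-Reasoning)
open import Relation.Nullary using (¬_; yes; no)
open import Function using (_∘′_)

module SubMultiset {A : Set} where

  infix 4 _≼_

  _≼_ : List A → List A → Set
  xs ≼ ys = ∃ λ rest → ys ↭ xs ++ rest

  ≼-refl : ∀ {xs} → xs ≼ xs
  ≼-refl {xs} = [] , ↭-reflexive (sym (++-identityʳ xs))

  []≼ : ∀ {ys} → [] ≼ ys
  []≼ {ys} = ys , ↭-refl

  ↭⇒≼ : ∀ {xs ys} → xs ↭ ys → xs ≼ ys
  ↭⇒≼ {xs} xs↭ys = [] , ↭-trans (↭-sym xs↭ys) (↭-reflexive (sym (++-identityʳ xs)))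

  ≼-trans : ∀ {xs ys zs} → xs ≼ ys → ys ≼ zs → xs ≼ zs
  ≼-trans {xs} (r , ys↭) (r' , zs↭) =
    r ++ r' , ↭-trans zs↭ (↭-trans (++⁺ʳ r' ys↭) (↭-++-assoc xs r r'))

  -- mutual inclusion is equality of multisets: the two remainders have
  -- total length 0
  ≼-antisym : ∀ {xs ys} → xs ≼ ys → ys ≼ xs → xs ↭ ys
  ≼-antisym {xs} {ys} (r , ys↭) (r' , xs↭) =
    ↭-sym (↭-trans ys↭ (↭-reflexive (trans (cong (xs ++_) r≡[]) (++-identityʳ xs))))
    where
    open ≡-Reasoning
    lengths : length xs + (length r + length r') ≡ length xs + 0
    lengths = begin
      length xs + (length r + length r') ≡⟨ +-assoc (length xs) _ _ ⟨
      length xs + length r + length r'   ≡⟨ cong (_+ length r') (length-++ xs) ⟨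
      length (xs ++ r) + length r'       ≡⟨ cong (_+ length r') (↭-length ys↭) ⟨
      length ys + length r'              ≡⟨ length-++ ys ⟨
      length (ys ++ r')                  ≡⟨ ↭-length xs↭ ⟨
      length xs                          ≡⟨ +-identityʳ (length xs) ⟨
      length xs + 0                      ∎
    empty : ∀ {zs : List A} → length zs ≡ 0 → zs ≡ []
    empty {[]} _ = refl
    r≡[] : r ≡ []
    r≡[] = empty (m+n≡0⇒m≡0 (length r) (+-cancelˡ-≡ (length xs) _ _ lengths))

  ≼-All : ∀ {P : A → Set} {xs ys} → xs ≼ ys → All P ys → All P xs
  ≼-All {xs = xs} (_ , ys↭) all = All.++⁻ˡ xs (All-resp-↭ ys↭ all)

  ≼-by-witness : ∀ xs {ys} → (∀ {x} → x ∈ xs → xs ≼ ys) → xs ≼ ys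
  ≼-by-witness []      _ = []≼
  ≼-by-witness (x ∷ _) h = h (here refl)

  concatMap-↭ : ∀ {B : Set} (f g : B → List A) (bs : List B) →
                (∀ {b} → b ∈ bs → f b ↭ g b) → concatMap f bs ↭ concatMap g bs
  concatMap-↭ f g []       _ = ↭-refl
  concatMap-↭ f g (b ∷ bs) h = ++⁺ (h (here refl)) (concatMap-↭ f g bs (h ∘′ there))

open SubMultiset

unique-keys-functional : ∀ {K B : Set} {k : K} {b b' : B} (ps : List (K × B)) →
  Unique (map proj₁ ps) → (k , b) ∈ ps → (k , b') ∈ ps → b ≡ b'
unique-keys-functional (_ ∷ ps) _ (here refl) (here refl) = refl
unique-keys-functional (_ ∷ ps) (fresh ∷ _) (here refl) (there m) =
  ⊥-elim (All.lookup fresh (∈-map⁺ proj₁ m) refl)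
unique-keys-functional (_ ∷ ps) (fresh ∷ _) (there m) (here refl) =
  ⊥-elim (All.lookup fresh (∈-map⁺ proj₁ m) refl)
unique-keys-functional (_ ∷ ps) (_ ∷ u) (there m) (there m') = unique-keys-functional ps u m m'

module KeyPartition {A K : Set} (key : A → K) (_≟_ : DecidableEquality K) where

  withKey : K → List A → List A
  withKey k = filter (λ x → key x ≟ k)

  byKeys : List K → List A → List A
  byKeys ks xs = concatMap (λ k → withKey k xs) ks

  byKeys-[] : ∀ ks → byKeys ks [] ≡ []
  byKeys-[] []       = refl
  byKeys-[] (_ ∷ ks) = byKeys-[] ks

  byKeys-absent : ∀ ks {x xs} → key x ∉ ks → byKeys ks (x ∷ xs) ≡ byKeys ks xs
  byKeys-absent []       _ = refl
  byKeys-absent (k ∷ ks) x∉ =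
    cong₂ _++_ (filter-reject (λ x → key x ≟ k) (x∉ ∘′ here)) (byKeys-absent ks (x∉ ∘′ there))

  byKeys-present : ∀ ks {x xs} → Unique ks → key x ∈ ks → byKeys ks (x ∷ xs) ↭ x ∷ byKeys ks xs
  byKeys-present (k ∷ ks) {x} {xs} (k∉ks ∷ _) (here x≡k) = ↭-reflexive (cong₂ _++_
    (filter-accept (λ x → key x ≟ k) x≡k)
    (byKeys-absent ks (λ x∈ks → All.lookup k∉ks x∈ks (sym x≡k))))
  byKeys-present (k ∷ ks) {x} {xs} (k∉ks ∷ u) (there x∈ks) = begin
    withKey k (x ∷ xs) ++ byKeys ks (x ∷ xs) ≡⟨ cong (_++ _) (filter-reject (λ x → key x ≟ k) x≢k) ⟩
    withKey k xs ++ byKeys ks (x ∷ xs)       ↭⟨ ++⁺ˡ (withKey k xs) (byKeys-present ks u x∈ks) ⟩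
    withKey k xs ++ x ∷ byKeys ks xs         ↭⟨ shift x (withKey k xs) (byKeys ks xs) ⟩
    x ∷ withKey k xs ++ byKeys ks xs         ∎
    where
    open PermutationReasoning
    x≢k : key x ≢ k
    x≢k x≡k = All.lookup k∉ks x∈ks (sym x≡k)

  byKeys-↭ : ∀ ks xs → Unique ks → All (λ x → key x ∈ ks) xs → byKeys ks xs ↭ xs
  byKeys-↭ ks []       _ _           = ↭-reflexive (byKeys-[] ks)
  byKeys-↭ ks (x ∷ xs) u (x∈ ∷ xs∈) = ↭-trans (byKeys-present ks u x∈) (prep x (byKeys-↭ ks xs u xs∈))

++-comparable : ∀ (a a' x y : Pid) → a ++ x ≡ a' ++ y →
                (∃ λ z → a' ≡ a ++ z) ⊎ (∃ λ z → a ≡ a' ++ z)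
++-comparable []      a'       x y e = inj₁ (a' , refl)
++-comparable (k ∷ a) []       x y e = inj₂ (k ∷ a , refl)
++-comparable (k ∷ a) (k' ∷ a') x y e with ∷-injective e
... | refl , e' with ++-comparable a a' x y e'
...   | inj₁ (z , refl) = inj₁ (z , refl)
...   | inj₂ (z , refl) = inj₂ (z , refl)

∈-subpid-++ : ∀ (a z : Pid) → a ≢ [] → a ∈ subpid (a ++ z)
∈-subpid-++ []          z a≢[] = ⊥-elim (a≢[] refl)
∈-subpid-++ (k ∷ [])    z _    = here refl
∈-subpid-++ (k ∷ m ∷ a) z _    = there (∈-map⁺ (k ∷_) (∈-subpid-++ (m ∷ a) z λ ()))

++-≢[] : ∀ (a x : Pid) → a ≢ [] → a ++ x ≢ []
++-≢[] []      x a≢[] _ = a≢[] refl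
++-≢[] (_ ∷ _) x _   ()

module PidTrees (N : TNet) where
  open TNet N hiding (trans)

  infix 4 _⊆_

  _⊆_ : PTree N → PTree N → Set
  _⊆_ = _⊆ᵗ_ N

  Matches : Pid × PTree N → Pid × PTree N → Set
  Matches c' c = proj₁ c' ≡ proj₁ c × proj₂ c' ⊆ proj₂ c

  _⊆ᶜ_ : List (Pid × PTree N) → List (Pid × PTree N) → Set
  cs' ⊆ᶜ cs = All (λ c' → Any (Matches c') cs) cs'

  ApartLabels : List (Pid × PTree N) → Set
  ApartLabels = AllPairs (λ c c' → Apart N (proj₁ c) (proj₁ c'))

  Typed : Marking → Set
  Typed M = ∀ s → All (HasType (ℓ s)) (M s)

  apart-++ : ∀ {a a'} (x y : Pid) → a ≢ [] → a' ≢ [] → Apart N a a' → a ++ x ≢ a' ++ y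
  apart-++ {a} {a'} x y a≢[] a'≢[] (_ , a∉ , a'∉) e with ++-comparable a a' x y e
  ... | inj₁ (z , refl) = a∉ (∈-subpid-++ a z a≢[])
  ... | inj₂ (z , refl) = a'∉ (∈-subpid-++ a' z a'≢[])

  data ChildNode (a : Pid) (u : PTree N) (cs : List (Pid × PTree N)) : Pid → PTree N → Set where
    inFirst : ∀ {π w} → (π , w) ∈ Trees N u → ChildNode a u cs (a ++ π) w
    inRest  : ∀ {π w} → (π , w) ∈ childTrees N cs → ChildNode a u cs π w

  childNode : ∀ a u cs {π w} → (π , w) ∈ childTrees N ((a , u) ∷ cs) → ChildNode a u cs π w
  childNode a u cs m with ∈-++⁻ (map _ (Trees N u)) m
  ... | inj₂ m' = inRest m'
  ... | inj₁ m' with ∈-map⁻ _ m'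
  ...   | _ , m'' , refl = inFirst m''

  inFirst⁺ : ∀ a u cs {π w} → (π , w) ∈ Trees N u → (a ++ π , w) ∈ childTrees N ((a , u) ∷ cs)
  inFirst⁺ a u cs m = ∈-++⁺ˡ (∈-map⁺ _ m)

  inRest⁺ : ∀ c cs {p} → p ∈ childTrees N cs → p ∈ childTrees N (c ∷ cs)
  inRest⁺ (_ , u) cs m = ∈-++⁺ʳ (map _ (Trees N u)) m

  childPid : ∀ cs {π w} → (π , w) ∈ childTrees N cs →
             ∃ λ c → c ∈ cs × ∃ λ π' → π ≡ proj₁ c ++ π'
  childPid ((a , u) ∷ cs) m with childNode a u cs m
  ... | inFirst {π'} _ = (a , u) , here refl , π' , refl
  ... | inRest m' with childPid cs m'
  ...   | c , c∈cs , π' , e = c , there c∈cs , π' , e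

  childPids : ∀ a u cs → map proj₁ (childTrees N ((a , u) ∷ cs)) ≡
              map (a ++_) (pids N u) ++ map proj₁ (childTrees N cs)
  childPids a u cs = begin
    map proj₁ (map _ (Trees N u) ++ childTrees N cs)             ≡⟨ map-++ proj₁ (map _ (Trees N u)) _ ⟩
    map proj₁ (map _ (Trees N u)) ++ map proj₁ (childTrees N cs) ≡⟨ cong (_++ _) (map-∘ (Trees N u)) ⟨
    map ((a ++_) ∘′ proj₁) (Trees N u) ++ _                       ≡⟨ cong (_++ _) (map-∘ (Trees N u)) ⟩
    map (a ++_) (pids N u) ++ map proj₁ (childTrees N cs)         ∎
    where open ≡-Reasoning

  mutual
    pids-unique : ∀ R → WF N R → Unique (pids N R)
    pids-unique (node M cs) (wf _ labels apart wfs) =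
      All.tabulate root-fresh ∷ childPids-unique cs labels apart wfs
      where
      root-fresh : ∀ {π} → π ∈ map proj₁ (childTrees N cs) → [] ≢ π
      root-fresh m []≡π with ∈-map⁻ proj₁ m
      ... | _ , m' , refl with childPid cs m'
      ...   | c , c∈cs , π' , e =
        ++-≢[] (proj₁ c) π' (proj₁ (All.lookup labels c∈cs)) (trans (sym e) (sym []≡π))

    childPids-unique : ∀ cs → All (λ c → proj₁ c ≢ [] × IsPid (proj₁ c)) cs →
      ApartLabels cs →
      All (λ c → WF N (proj₂ c)) cs → Unique (map proj₁ (childTrees N cs))
    childPids-unique []             _                   _                 _          = []
    childPids-unique ((a , u) ∷ cs) ((a≢[] , _) ∷ labels) (a-apart ∷ apart) (wfu ∷ wfs) =
      subst Unique (sym (childPids a u cs))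
        (Unique.++⁺ (Unique.map⁺ (++-cancelˡ a _ _) (pids-unique u wfu))
                    (childPids-unique cs labels apart wfs) disjoint)
      where
      disjoint : ∀ {π} → ¬ (π ∈ map (a ++_) (pids N u) × π ∈ map proj₁ (childTrees N cs))
      disjoint (m₁ , m₂) with ∈-map⁻ (a ++_) m₁ | ∈-map⁻ proj₁ m₂
      ... | x , _ , refl | _ , m , e with childPid cs m
      ...   | c , c∈cs , π' , e' =
        apart-++ x π' a≢[] (proj₁ (All.lookup labels c∈cs)) (All.lookup a-apart c∈cs) (trans e e')

  node-unique : ∀ {R π w w'} → WF N R → (π , w) ∈ Trees N R → (π , w') ∈ Trees N R → w ≡ w'
  node-unique {R} wfR = unique-keys-functional (Trees N R) (pids-unique R wfR)

  mutual
    node-typed : ∀ {R π w} → WF N R → (π , w) ∈ Trees N R → Typed (rootM N w)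
    node-typed (wf typed _ _ _) (here refl) = typed
    node-typed (wf _ _ _ wfs)   (there m)   = childNode-typed wfs m

    childNode-typed : ∀ {cs π w} → All (λ c → WF N (proj₂ c)) cs → (π , w) ∈ childTrees N cs →
                      Typed (rootM N w)
    childNode-typed {(a , u) ∷ cs} (wfu ∷ wfs) m with childNode a u cs m
    ... | inFirst m' = node-typed wfu m'
    ... | inRest m'  = childNode-typed wfs m'

  mutual
    ⊆-node : ∀ {t R} → t ⊆ R → ∀ {π u} → (π , u) ∈ Trees N t →
             ∃ λ w → (π , w) ∈ Trees N R × rootM N u ≤ᴹ rootM N w
    ⊆-node {R = node M cs} (⊆node M'≤M _) (here refl) = node M cs , here refl , M'≤M
    ⊆-node {node _ cs'} {node _ cs} (⊆node _ sub) (there m) with ⊆-childNode cs' cs sub m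
    ... | w , w∈ , u≤w = w , there w∈ , u≤w

    ⊆-childNode : ∀ cs' cs → cs' ⊆ᶜ cs →
      ∀ {π u} → (π , u) ∈ childTrees N cs' →
      ∃ λ w → (π , w) ∈ childTrees N cs × rootM N u ≤ᴹ rootM N w
    ⊆-childNode ((a , u₀) ∷ cs') cs (match ∷ sub) m with childNode a u₀ cs' m
    ... | inFirst m' = ⊆-matchNode a u₀ cs match m'
    ... | inRest m'  = ⊆-childNode cs' cs sub m'

    ⊆-matchNode : ∀ a u₀ cs → Any (Matches (a , u₀)) cs →
      ∀ {π u} → (π , u) ∈ Trees N u₀ →
      ∃ λ w → (a ++ π , w) ∈ childTrees N cs × rootM N u ≤ᴹ rootM N w
    ⊆-matchNode a u₀ ((_ , v) ∷ cs) (here (refl , u₀⊆v)) m with ⊆-node u₀⊆v m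
    ... | w , w∈ , u≤w = w , inFirst⁺ a v cs w∈ , u≤w
    ⊆-matchNode a u₀ (c ∷ cs) (there match) m with ⊆-matchNode a u₀ cs match m
    ... | w , w∈ , u≤w = w , inRest⁺ c cs w∈ , u≤w

  path-node : ∀ {R π M'} → ContainsPath N R π M' →
              ∃ λ w → (π , w) ∈ Trees N R × M' ≤ᴹ rootM N w
  path-node (t , (_ , _ , _ , (u , u∈ , _ , u≈M') , _) , t⊆R) with ⊆-node t⊆R u∈
  ... | w , w∈ , u≤w = w , w∈ , λ s → ≼-trans (↭⇒≼ (↭-sym (u≈M' s))) (u≤w s)

  mutual
    relabel : (Pid → Marking) → PTree N → PTree N
    relabel f (node _ cs) = node (f []) (relabelChildren f cs)

    relabelChildren : (Pid → Marking) → List (Pid × PTree N) → List (Pid × PTree N)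
    relabelChildren f []             = []
    relabelChildren f ((a , u) ∷ cs) = (a , relabel (f ∘′ (a ++_)) u) ∷ relabelChildren f cs

  mutual
    relabel-root : ∀ f R {π w} → (π , w) ∈ Trees N (relabel f R) → rootM N w ≡ f π
    relabel-root f (node _ cs) (here refl) = refl
    relabel-root f (node _ cs) (there m)   = relabelChildren-root f cs m

    relabelChildren-root : ∀ f cs {π w} → (π , w) ∈ childTrees N (relabelChildren f cs) → rootM N w ≡ f π
    relabelChildren-root f ((a , u) ∷ cs) m with childNode a (relabel (f ∘′ (a ++_)) u) (relabelChildren f cs) m
    ... | inFirst m' = relabel-root (f ∘′ (a ++_)) u m'
    ... | inRest m'  = relabelChildren-root f cs m'

  relabel-labels : ∀ {Q : Pid → Set} f cs → All (Q ∘′ proj₁) cs → All (Q ∘′ proj₁) (relabelChildren f cs)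
  relabel-labels f []             []       = []
  relabel-labels f ((a , u) ∷ cs) (q ∷ qs) = q ∷ relabel-labels f cs qs

  relabel-apart : ∀ f cs → ApartLabels cs →
                  ApartLabels (relabelChildren f cs)
  relabel-apart f []             []                 = []
  relabel-apart f ((a , u) ∷ cs) (a-apart ∷ apart) =
    relabel-labels {Apart N a} f cs a-apart ∷ relabel-apart f cs apart

  mutual
    relabel-WF : ∀ f R → WF N R → (∀ {π w} → (π , w) ∈ Trees N R → Typed (f π)) →
                 WF N (relabel f R)
    relabel-WF f (node _ cs) (wf _ labels apart wfs) typed =
      wf (typed (here refl)) (relabel-labels f cs labels) (relabel-apart f cs apart)
         (relabelChildren-WF f cs wfs (typed ∘′ there))

    relabelChildren-WF : ∀ f cs → All (λ c → WF N (proj₂ c)) cs →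
      (∀ {π w} → (π , w) ∈ childTrees N cs → Typed (f π)) →
      All (λ c → WF N (proj₂ c)) (relabelChildren f cs)
    relabelChildren-WF f []             []          _     = []
    relabelChildren-WF f ((a , u) ∷ cs) (wfu ∷ wfs) typed =
      relabel-WF (f ∘′ (a ++_)) u wfu (typed ∘′ inFirst⁺ a u cs) ∷
      relabelChildren-WF f cs wfs (typed ∘′ inRest⁺ (a , u) cs)

  mutual
    relabel-⊆ : ∀ f R → (∀ {π w} → (π , w) ∈ Trees N R → f π ≤ᴹ rootM N w) → relabel f R ⊆ R
    relabel-⊆ f (node _ cs) below = ⊆node (below (here refl)) (relabelChildren-⊆ f cs (below ∘′ there))

    relabelChildren-⊆ : ∀ f cs → (∀ {π w} → (π , w) ∈ childTrees N cs → f π ≤ᴹ rootM N w) →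
      relabelChildren f cs ⊆ᶜ cs
    relabelChildren-⊆ f []             _     = []
    relabelChildren-⊆ f ((a , u) ∷ cs) below =
      here (refl , relabel-⊆ (f ∘′ (a ++_)) u (below ∘′ inFirst⁺ a u cs)) ∷
      All.map there (relabelChildren-⊆ f cs (below ∘′ inRest⁺ (a , u) cs))

  mutual
    ⊆-relabel : ∀ f {t R} → t ⊆ R → (∀ {π u} → (π , u) ∈ Trees N t → rootM N u ≤ᴹ f π) → t ⊆ relabel f R
    ⊆-relabel f {node _ cs'} {node _ cs} (⊆node _ sub) bounded =
      ⊆node (bounded (here refl)) (⊆-relabelChildren f cs' cs sub (bounded ∘′ there))

    ⊆-relabelChildren : ∀ f cs' cs → cs' ⊆ᶜ cs →
      (∀ {π u} → (π , u) ∈ childTrees N cs' → rootM N u ≤ᴹ f π) →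
      cs' ⊆ᶜ relabelChildren f cs
    ⊆-relabelChildren f []              cs []            _       = []
    ⊆-relabelChildren f ((a , u) ∷ cs') cs (match ∷ sub) bounded =
      ⊆-relabelMatch f a u cs match (bounded ∘′ inFirst⁺ a u cs') ∷
      ⊆-relabelChildren f cs' cs sub (bounded ∘′ inRest⁺ (a , u) cs')

    ⊆-relabelMatch : ∀ f a u cs → Any (Matches (a , u)) cs →
      (∀ {π w} → (π , w) ∈ Trees N u → rootM N w ≤ᴹ f (a ++ π)) →
      Any (Matches (a , u)) (relabelChildren f cs)
    ⊆-relabelMatch f a u (_ ∷ cs) (here (refl , u⊆v)) bounded = here (refl , ⊆-relabel (f ∘′ (a ++_)) u⊆v bounded)
    ⊆-relabelMatch f a u (_ ∷ cs) (there match)       bounded = there (⊆-relabelMatch f a u cs match bounded)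

module Located (N : TNet) (M : TNet.Marking N) where
  open TNet N hiding (trans)
  open PidTrees N

  Need-∈ : ∀ {π s v} → v ∈ Need N M π s → s ≢ sη × v ∈ M s × loc N s v ≡ π
  Need-∈ {π} {s} v∈ with s ≟F sη
  Need-∈ () | yes _
  ... | no s≢sη = s≢sη , ∈-filter⁻ (λ v → loc N s v ≟ₚ π) v∈

  Need-ordinary : ∀ {π s} → s ≢ sη → Need N M π s ≡ filter (λ v → loc N s v ≟ₚ π) (M s)
  Need-ordinary {π} {s} s≢sη with s ≟F sη
  ... | yes s≡sη = ⊥-elim (s≢sη s≡sη)
  ... | no _     = refl

  module _ {R : PTree N} (wfR : WF N R) (req : Requires N R M) where

    location-node : ∀ {s v} → s ≢ sη → v ∈ M s →
                    ∃ λ w → (loc N s v , w) ∈ Trees N R × Need N M (loc N s v) ≤ᴹ rootM N w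
    location-node s≢sη v∈ = path-node (proj₁ (proj₂ req _ s≢sη _ v∈))

    located-in : ∀ {s} → s ≢ sη → All (λ v → loc N s v ∈ pids N R) (M s)
    located-in s≢sη = All.tabulate λ v∈ → ∈-map⁺ proj₁ (proj₁ (proj₂ (location-node s≢sη v∈)))

    -- a pid names at most one node of R, so a bound found at one name of it
    -- holds at every name of it
    same-node : ∀ {π π' w w'} → π' ≡ π → (π' , w') ∈ Trees N R → (π , w) ∈ Trees N R →
                Need N M π' ≤ᴹ rootM N w' → Need N M π ≤ᴹ rootM N w
    same-node refl w'∈ w∈ Need≤w' with node-unique wfR w'∈ w∈
    ... | refl = Need≤w'

    located-below : ∀ {π w s v} → (π , w) ∈ Trees N R → v ∈ Need N M π s → Need N M π s ≼ rootM N w s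
    located-below {π} {w} {s} w∈ v∈ =
      let s≢sη , v∈M , loc≡π  = Need-∈ {π} {s} v∈
          _ , w'∈ , Need≤w'  = location-node s≢sη v∈M
      in same-node loc≡π w'∈ w∈ Need≤w' s

    Need-below : ∀ {π w} → (π , w) ∈ Trees N R → Need N M π ≤ᴹ rootM N w
    Need-below {π} w∈ s = ≼-by-witness (Need N M π s) (located-below w∈)

    core : PTree N
    core = relabel (Need N M) R

    core-WF : WF N core
    core-WF = relabel-WF (Need N M) R wfR λ w∈ s → ≼-All (Need-below w∈ s) (node-typed wfR w∈ s)

    core-⊆ : core ⊆ R
    core-⊆ = relabel-⊆ (Need N M) R Need-below

    path-in-core : ∀ {π M'} → M' ≤ᴹ Need N M π → ContainsPath N R π M' → ContainsPath N core π M'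
    path-in-core {π} M'≤Need (t , isPath@(wft , _ , _ , (u , u∈ , _ , u≈M') , others) , t⊆R) =
      t , isPath , ⊆-relabel (Need N M) t⊆R bounded
      where
      bounded : ∀ {π' u'} → (π' , u') ∈ Trees N t → rootM N u' ≤ᴹ Need N M π'
      bounded {π'} u'∈ with π' ≟ₚ π
      ... | yes refl rewrite node-unique wft u'∈ u∈ = λ s → ≼-trans (↭⇒≼ (u≈M' s)) (M'≤Need s)
      ... | no π'≢π = λ s → ≼-trans (↭⇒≼ (others π' _ u'∈ π'≢π s)) []≼

    core-requires : Requires N core M
    core-requires =
      (λ π i g∈ → Product.map (path-in-core nothing) (path-in-core nothing) (proj₁ req π i g∈)) ,
      (λ s s≢sη v v∈ → Product.map (path-in-core (λ _ → ≼-refl)) (All.map (path-in-core nothing))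
                                   (proj₂ req s s≢sη v v∈))
      where
      nothing : ∀ {M'} → ∅ᴹ ≤ᴹ M'
      nothing _ = []≼

  -- in a representation every node π carries exactly the tokens located at π:
  -- by minimality R ⊆ core, which bounds the node markings from above
  node-exact : ∀ {R} → _∈repr_ N R M → ∀ {π w} → (π , w) ∈ Trees N R → ∀ s → rootM N w s ↭ Need N M π s
  node-exact {R} (wfR , _ , req , minimal) {π} {w} w∈ s = ≼-antisym Need-above (Need-below wfR req w∈ s)
    where
    R⊆core : R ⊆ core wfR req
    R⊆core = minimal (core wfR req) (core-WF wfR req) (core-⊆ wfR req) (core-requires wfR req)
    Need-above : rootM N w s ≼ Need N M π s
    Need-above with ⊆-node R⊆core w∈
    ... | w' , w'∈ , w≤w' = subst (λ M' → rootM N w s ≼ M' s) (relabel-root (Need N M) R w'∈) (w≤w' s)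

-- The union of the node markings of R at s lists, node by node, the tokens
-- of M(s) located at the distinct pids of R; these cover M(s).
proposition3 : (N : TNet) (M : TNet.Marking N) → Reachable N M →
    (R : PTree N) → _∈repr_ N R M →
    ∀ (s : TNet.Place N) → s ≢ TNet.sη N → M s ↭ unionTrees N R s
proposition3 N M _ R repr@(wfR , _ , req , _) s s≢sη = ↭-sym (begin
  unionTrees N R s                                    ↭⟨ concatMap-↭ _ _ (Trees N R) (λ w∈ → node-exact repr w∈ s) ⟩
  concatMap (λ p → Need N M (proj₁ p) s) (Trees N R)  ≡⟨ concatMap-map _ proj₁ (Trees N R) ⟨
  concatMap (λ π → Need N M π s) (pids N R)           ≡⟨ concatMap-cong (λ _ → Need-ordinary s≢sη) (pids N R) ⟩
  byKeys (pids N R) (M s)                             ↭⟨ byKeys-↭ (pids N R) (M s) (pids-unique R wfR) (located-in wfR req s≢sη) ⟩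
  M s                                                 ∎)
  where
  open PermutationReasoning
  open PidTrees N
  open Located N M
  open KeyPartition (loc N s) _≟ₚ_
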